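{- Let $V$ be a vector space of finite dimension $r$ over $\mathbb{F}_q$ with $q\neq 2$, and let $M$ be a maximal $S_h$-linear set in $V$ with $2h<r\leq|M|$. Then $\boldsymbol{0}\in M$.
   Context: For a non-empty subset $A$ of $V$ and a positive integer $h\leq|A|$, an $h$-linear combination of $A$ is an expression $\lambda_1\boldsymbol{a}_1+\cdots+\lambda_h\boldsymbol{a}_h$ with $\lambda_i\in\mathbb{F}_q^*$ and $\boldsymbol{a}_1,\dots,\boldsymbol{a}_h$ distinct elements of $A$. $A$ is an $S_h$-linear set if all $h$-linear combinations of elements of $A$, omitting permutations of the summands, yield distinct elements of $V$ (combinations differing only in the scalar attached to $\boldsymbol{0}$ being regarded as the same). An $S_h$-linear set $M$ is maximal if for every $S_h$-linear set $A$ with $M\subseteq A\subseteq V$ one has $M=A$. -}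

module Defs where

open import Level using (0ℓ)
open import Data.Nat using (ℕ; zero; suc)
open import Data.Fin using (Fin)
import Data.Fin as Fin
open import Data.Vec using (Vec; replicate; zipWith; map)
open import Data.List using (List; length)
open import Data.List.Membership.Propositional using (_∈_)
open import Data.List.Relation.Unary.Unique.Propositional using (Unique)
open import Data.Product using (Σ; _×_; ∃)
open import Data.Fin.Permutation using (Permutation′; _⟨$⟩ʳ_)
open import Relation.Binary.PropositionalEquality using (_≡_; _≢_)
open import Relation.Nullary using (¬_)
open import Function.Definitions using (Injective)
open import Algebra.Structures using (IsCommutativeRing)

record FiniteField : Set₁ where
  field
    Carrier : Set
    _+_ _*_ : Carrier → Carrier → Carrier
    -_ : Carrier → Carrier
    0# 1# : Carrier
    isCommutativeRing : IsCommutativeRing _≡_ _+_ _*_ -_ 0# 1#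
    0≢1 : 0# ≢ 1#
    inv : (x : Carrier) → x ≢ 0# → Σ Carrier (λ y → x * y ≡ 1#)
    elements : List Carrier
    elements-complete : (x : Carrier) → x ∈ elements
    elements-unique : Unique elements

  order : ℕ
  order = length elements

module _ (F : FiniteField) where
  open FiniteField F

  V : ℕ → Set
  V r = Vec Carrier r

  𝟎 : ∀ {r} → V r
  𝟎 = replicate _ 0#

  _⊕_ : ∀ {r} → V r → V r → V r
  _⊕_ = zipWith _+_

  _·_ : ∀ {r} → Carrier → V r → V r
  c · v = map (c *_) v

  sumV : ∀ {r h} → (Fin h → V r) → V r
  sumV {h = zero} f = 𝟎
  sumV {h = suc h} f = f Fin.zero ⊕ sumV (λ i → f (Fin.suc i))

  record FinSubset (r : ℕ) : Set where
    constructor finSubset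
    field
      elems : List (V r)
      unique : Unique elems

  open FinSubset public

  card : ∀ {r} → FinSubset r → ℕ
  card A = length (elems A)

  _⊆ₛ_ : ∀ {r} → FinSubset r → FinSubset r → Set
  A ⊆ₛ B = ∀ {v} → v ∈ elems A → v ∈ elems B

  record LinComb {r : ℕ} (h : ℕ) (A : FinSubset r) : Set where
    field
      vec : Fin h → V r
      vec-inj : Injective _≡_ _≡_ vec
      vec-mem : ∀ i → vec i ∈ elems A
      coeff : Fin h → Carrier
      coeff-nz : ∀ i → coeff i ≢ 0#

  open LinComb public

  value : ∀ {r h} {A : FinSubset r} → LinComb h A → V r
  value c = sumV (λ i → coeff c i · vec c i)

  -- Two h-linear combinations are the same (as formal expressions) if they
  -- differ only by a permutation of the summands, and by the scalar
  -- attached to the zero vector.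
  SameComb : ∀ {r h} {A : FinSubset r} → LinComb h A → LinComb h A → Set
  SameComb {h = h} c d =
    Σ (Permutation′ h) λ σ → ∀ i →
      (vec d (σ ⟨$⟩ʳ i) ≡ vec c i) × (vec c i ≢ 𝟎 → coeff d (σ ⟨$⟩ʳ i) ≡ coeff c i)

  IsSₕLinear : ∀ {r} (h : ℕ) → FinSubset r → Set
  IsSₕLinear h A = (c d : LinComb h A) → value c ≡ value d → SameComb c d

  IsMaximalSₕLinear : ∀ {r} (h : ℕ) → FinSubset r → Set
  IsMaximalSₕLinear h M =
    IsSₕLinear h M ×
    ((A : FinSubset _) → IsSₕLinear h A → M ⊆ₛ A → A ⊆ₛ M)

-- Suppose 𝟎 ∉ M; we show that M ∪ {𝟎} is still S_h-linear, contradicting the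
-- maximality of M. Let c, d
-- be combinations with equal values. If both use 𝟎, replace 𝟎 in each by a vector
-- e ∈ M used by neither (it exists since |M| > 2h): the results are equal combinations
-- of M, hence the same up to permutation, and so were c and d. If only c uses 𝟎, pick a
-- vector b of d not used by c and a scalar t ∉ {0, -μ}, where μ is the coefficient of b
-- in d; replacing 𝟎 in c by t b and μ by μ + t in d gives equal combinations of M, so
-- μ + t = t and μ = 0, which is absurd. This step is where q ≠ 2 is needed.
module Submission where

open import Defs hiding (_⊕_; _·_)
open import Data.Nat using (ℕ; _≤_; _<_; _*_)
open import Data.List.Membership.Propositional using (_∈_)
open import Relation.Binary.PropositionalEquality using (_≢_)

open import Level using (0ℓ)
import Data.Nat as ℕ
import Data.Nat.Properties as ℕₚ
open import Data.Fin using (Fin; zero; suc; punchOut)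
import Data.Fin.Properties as Finₚ
open import Data.Fin.Permutation using (Permutation′; _⟨$⟩ʳ_)
open import Data.Vec using ([]; _∷_; map)
open import Data.Vec.Properties
  using (≡-dec; zipWith-assoc; zipWith-comm; zipWith-identityˡ; zipWith-identityʳ;
         zipWith-inverseˡ; zipWith-inverseʳ)
open import Data.Vec.Functional using (updateAt)
open import Data.Vec.Functional.Properties using (updateAt-updates; updateAt-minimal)
open import Data.List using (List; []; _∷_; length; lookup; tabulate; _++_)
open import Data.List.Properties using (length-++; length-tabulate)
open import Data.List.Membership.Propositional using (_∉_; find)
open import Data.List.Membership.Propositional.Properties using (∈-lookup; ∈-tabulate⁺; ∈-++⁺ˡ; ∈-++⁺ʳ)
open import Data.List.Membership.Setoid.Properties using (index-injective)
open import Data.List.Relation.Binary.Subset.Propositional using (_⊆_)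
open import Data.List.Relation.Unary.Any using (here; there)
import Data.List.Relation.Unary.Any as Any
open import Data.List.Relation.Unary.All using (all?; []; _∷_)
import Data.List.Relation.Unary.All as All
open import Data.List.Relation.Unary.All.Properties.Core using (¬All⇒Any¬; ¬Any⇒All¬)
open import Data.List.Relation.Unary.AllPairs using ([]; _∷_)
open import Data.List.Relation.Unary.Unique.Propositional using (Unique)
open import Data.Product using (_×_; ∃; _,_; proj₁; proj₂)
open import Function using (_∘_; const)
open import Function.Definitions using (Injective)
open import Function.Bundles using (Injection)
open import Function.Properties.Inverse using (↔⇒↣)
open import Relation.Nullary using (¬_; Dec; yes; no; contradiction)
open import Relation.Unary using (Pred)
open import Relation.Binary.Definitions using (DecidableEquality)
open import Relation.Binary.PropositionalEquality
  using (_≡_; refl; sym; trans; cong; cong₂; subst; isEquivalence; setoid; module ≡-Reasoning)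
open import Algebra.Bundles using (AbelianGroup)
open import Algebra.Structures using (IsAbelianGroup; IsCommutativeRing)
import Algebra.Properties.AbelianGroup as AbelianGroupProperties
import Algebra.Properties.CommutativeSemigroup as CommutativeSemigroupProperties

module _ {a} {A : Set a} where

  Unique⇒lookup-injective : {xs : List A} → Unique xs → Injective _≡_ _≡_ (lookup xs)
  Unique⇒lookup-injective {x ∷ xs} (_ ∷ _) {zero} {zero} _ = refl
  Unique⇒lookup-injective {x ∷ xs} (x∉xs ∷ _) {zero} {suc j} eq =
    contradiction eq (All.lookup x∉xs (∈-lookup j))
  Unique⇒lookup-injective {x ∷ xs} (x∉xs ∷ _) {suc i} {zero} eq =
    contradiction (sym eq) (All.lookup x∉xs (∈-lookup i))
  Unique⇒lookup-injective {x ∷ xs} (_ ∷ xs-unique) {suc i} {suc j} eq =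
    cong suc (Unique⇒lookup-injective xs-unique eq)

  Unique∧⊆⇒length≤ : {xs ys : List A} → Unique xs → xs ⊆ ys → length xs ≤ length ys
  Unique∧⊆⇒length≤ {xs} {ys} xs-unique xs⊆ys = Finₚ.injective⇒≤ position-injective
    where
    position : Fin (length xs) → Fin (length ys)
    position k = Any.index (xs⊆ys (∈-lookup k))

    position-injective : Injective _≡_ _≡_ position
    position-injective {i} {j} eq = Unique⇒lookup-injective xs-unique
      (index-injective (setoid A) (xs⊆ys (∈-lookup i)) (xs⊆ys (∈-lookup j)) eq)

  module _ (_≟_ : DecidableEquality A) where
    open import Data.List.Membership.DecPropositional _≟_ using (_∈?_)

    length<⇒∃∈∉ : {xs ys : List A} → Unique xs → length ys < length xs → ∃ λ x → x ∈ xs × x ∉ ys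
    length<⇒∃∈∉ {xs} {ys} xs-unique ys<xs with all? (_∈? ys) xs
    ... | yes xs⊆ys = contradiction (Unique∧⊆⇒length≤ xs-unique (All.lookup xs⊆ys)) (ℕₚ.<⇒≱ ys<xs)
    ... | no xs⊈ys = find (¬All⇒Any¬ (_∈? ys) xs xs⊈ys)

injective⇒hits : ∀ {n} (f : Fin n → Fin n) → Injective _≡_ _≡_ f → (i : Fin n) → ∃ λ j → f j ≡ i
injective⇒hits {ℕ.suc n} f f-injective i with Finₚ.any? (λ j → f j Finₚ.≟ i)
... | yes hit = hit
... | no miss = contradiction (Finₚ.injective⇒≤ punched-injective) ℕₚ.1+n≰n
  where
  i≢f : ∀ j → i ≢ f j
  i≢f j i≡fj = miss (j , sym i≡fj)

  punched : Fin (ℕ.suc n) → Fin n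
  punched j = punchOut (i≢f j)

  punched-injective : Injective _≡_ _≡_ punched
  punched-injective eq = f-injective (Finₚ.punchOut-injective (i≢f _) (i≢f _) eq)

-- If every g j had a preimage under f, choosing them would inject Fin n into itself
-- missing i.
∃-outside-image : ∀ {a n} {X : Set a} → DecidableEquality X → (f g : Fin n → X) →
                  Injective _≡_ _≡_ g → (i : Fin n) → (∀ j → g j ≢ f i) →
                  ∃ λ j → ∀ k → f k ≢ g j
∃-outside-image {n = n} _≟_ f g g-injective i f[i]∉g
  with Finₚ.all? (λ j → Finₚ.any? (λ k → f k ≟ g j))
... | no ¬all = let j , ¬∃k = Finₚ.¬∀⟶∃¬ n _ (λ j → Finₚ.any? (λ k → f k ≟ g j)) ¬all
                in j , λ k fk≡gj → ¬∃k (k , fk≡gj)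
... | yes preimage =
  let j , kj≡i = injective⇒hits k k-injective i
  in contradiction (trans (sym (proj₂ (preimage j))) (cong f kj≡i)) (f[i]∉g j)
  where
  k : Fin n → Fin n
  k j = proj₁ (preimage j)

  k-injective : Injective _≡_ _≡_ k
  k-injective {j₁} {j₂} eq =
    g-injective (trans (sym (proj₂ (preimage j₁))) (trans (cong f eq) (proj₂ (preimage j₂))))

module _ {a} {A : Set a} {n : ℕ} where

  infixl 9 _[_]≔_
  _[_]≔_ : (Fin n → A) → Fin n → A → Fin n → A
  f [ i ]≔ x = updateAt f i (const x)

  []≔-updates : (f : Fin n → A) (i : Fin n) (x : A) → (f [ i ]≔ x) i ≡ x
  []≔-updates f i x = updateAt-updates i f

  []≔-minimal : (f : Fin n → A) (i : Fin n) (x : A) {k : Fin n} → k ≢ i → (f [ i ]≔ x) k ≡ f k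
  []≔-minimal f i x {k} = updateAt-minimal k i f

  []≔-preserves : ∀ {p} (P : Pred A p) {f : Fin n → A} {i : Fin n} {x : A} →
                  P x → (∀ k → k ≢ i → P (f k)) → ∀ k → P ((f [ i ]≔ x) k)
  []≔-preserves P {f} {i} {x} px pf k with k Finₚ.≟ i
  ... | yes refl = subst P (sym ([]≔-updates f k x)) px
  ... | no k≢i = subst P (sym ([]≔-minimal f i x k≢i)) (pf k k≢i)

  []≔-injective : {f : Fin n → A} {i : Fin n} {x : A} → Injective _≡_ _≡_ f →
                  (∀ k → k ≢ i → f k ≢ x) → Injective _≡_ _≡_ (f [ i ]≔ x)
  []≔-injective {f} {i} {x} f-injective fresh {k} {l} eq with k Finₚ.≟ i | l Finₚ.≟ i
  ... | yes k≡i | yes l≡i = trans k≡i (sym l≡i)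
  ... | yes refl | no l≢i =
    contradiction (trans (sym ([]≔-minimal f i x l≢i)) (trans (sym eq) ([]≔-updates f i x))) (fresh l l≢i)
  ... | no k≢i | yes refl =
    contradiction (trans (sym ([]≔-minimal f i x k≢i)) (trans eq ([]≔-updates f i x))) (fresh k k≢i)
  ... | no k≢i | no l≢i =
    f-injective (trans (sym ([]≔-minimal f i x k≢i)) (trans eq ([]≔-minimal f i x l≢i)))

module _ (F : FiniteField) where
  open FiniteField F hiding (_*_)
  open IsCommutativeRing isCommutativeRing
    using (+-assoc; +-comm; +-identityˡ; +-identityʳ; -‿inverseˡ; -‿inverseʳ; distribʳ; zeroʳ;
           +-isAbelianGroup)
  open ≡-Reasoning

  private
    infixl 6 _⊕_
    infixr 7 _·_

    _⊕_ : ∀ {r} → V F r → V F r → V F r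
    _⊕_ = Defs._⊕_ F

    _·_ : ∀ {r} → Carrier → V F r → V F r
    _·_ = Defs._·_ F

  _≟_ : DecidableEquality Carrier
  x ≟ y with Any.index (elements-complete x) Finₚ.≟ Any.index (elements-complete y)
  ... | yes same = yes (index-injective (setoid Carrier) (elements-complete x) (elements-complete y) same)
  ... | no differ = no λ { refl → differ refl }

  _≟ᵥ_ : ∀ {r} → DecidableEquality (V F r)
  _≟ᵥ_ = ≡-dec _≟_

  order≢2⇒2<order : order ≢ 2 → 2 < order
  order≢2⇒2<order order≢2 =
    ℕₚ.≤∧≢⇒< (Unique∧⊆⇒length≤ 0,1-unique (λ _ → elements-complete _)) (order≢2 ∘ sym)
    where
    0,1-unique : Unique (0# ∷ 1# ∷ [])
    0,1-unique = (0≢1 ∷ []) ∷ [] ∷ []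

  +-abelianGroup : AbelianGroup 0ℓ 0ℓ
  +-abelianGroup = record { isAbelianGroup = +-isAbelianGroup }

  open AbelianGroupProperties +-abelianGroup using (inverseʳ-unique) renaming (∙-cancelʳ to +-cancelʳ)

  ∃-shift-avoiding-0 : 2 < order → (μ : Carrier) → ∃ λ t → t ≢ 0# × μ + t ≢ 0#
  ∃-shift-avoiding-0 2<q μ with length<⇒∃∈∉ _≟_ {ys = 0# ∷ - μ ∷ []} elements-unique 2<q
  ... | t , _ , t∉ = t , t∉ ∘ here , λ μ+t≡0 → t∉ (there (here (inverseʳ-unique μ t μ+t≡0)))

  ⊕-isAbelianGroup : ∀ r → IsAbelianGroup _≡_ (_⊕_ {r}) (𝟎 F) (map -_)
  ⊕-isAbelianGroup r = record
    { isGroup = record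
      { isMonoid = record
        { isSemigroup = record
          { isMagma = record { isEquivalence = isEquivalence ; ∙-cong = cong₂ _⊕_ }
          ; assoc = zipWith-assoc +-assoc
          }
        ; identity = zipWith-identityˡ +-identityˡ , zipWith-identityʳ +-identityʳ
        }
      ; inverse = zipWith-inverseˡ -‿inverseˡ , zipWith-inverseʳ -‿inverseʳ
      ; ⁻¹-cong = cong (map -_)
      }
    ; comm = zipWith-comm +-comm
    }

  ⊕-abelianGroup : ℕ → AbelianGroup 0ℓ 0ℓ
  ⊕-abelianGroup r = record { isAbelianGroup = ⊕-isAbelianGroup r }

  module ⊕-Properties {r : ℕ} where
    open AbelianGroup (⊕-abelianGroup r) public
      using () renaming (assoc to ⊕-assoc; comm to ⊕-comm; identityʳ to ⊕-identityʳ)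
    open AbelianGroupProperties (⊕-abelianGroup r) public
      using () renaming (∙-cancelʳ to ⊕-cancelʳ)
    open CommutativeSemigroupProperties (AbelianGroup.commutativeSemigroup (⊕-abelianGroup r)) public
      using (xy∙z≈zy∙x)

  open ⊕-Properties

  ·-𝟎 : ∀ {r} c → c · 𝟎 F {r} ≡ 𝟎 F
  ·-𝟎 {ℕ.zero} c = refl
  ·-𝟎 {ℕ.suc r} c = cong₂ _∷_ (zeroʳ c) (·-𝟎 c)

  ·-distribʳ : ∀ {r} a b (u : V F r) → (a + b) · u ≡ a · u ⊕ b · u
  ·-distribʳ a b [] = refl
  ·-distribʳ a b (x ∷ u) = cong₂ _∷_ (distribʳ x a b) (·-distribʳ a b u)

  sumV-cong : ∀ {r h} {f g : Fin h → V F r} → (∀ k → f k ≡ g k) → sumV F f ≡ sumV F g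
  sumV-cong {h = ℕ.zero} f≗g = refl
  sumV-cong {h = ℕ.suc h} f≗g = cong₂ _⊕_ (f≗g zero) (sumV-cong (f≗g ∘ suc))

  sumV-exchange : ∀ {r h} (f g : Fin h → V F r) (i : Fin h) → (∀ k → k ≢ i → f k ≡ g k) →
                  sumV F f ⊕ g i ≡ sumV F g ⊕ f i
  sumV-exchange {h = ℕ.suc h} f g zero f≗g = begin
    f zero ⊕ sumV F (f ∘ suc) ⊕ g zero  ≡⟨ cong (λ s → f zero ⊕ s ⊕ g zero) same-tail ⟩
    f zero ⊕ sumV F (g ∘ suc) ⊕ g zero  ≡⟨ xy∙z≈zy∙x _ _ _ ⟩
    g zero ⊕ sumV F (g ∘ suc) ⊕ f zero  ∎
    where
    same-tail : sumV F (f ∘ suc) ≡ sumV F (g ∘ suc)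
    same-tail = sumV-cong (λ k → f≗g (suc k) λ ())
  sumV-exchange {h = ℕ.suc h} f g (suc i) f≗g = begin
    f zero ⊕ sumV F (f ∘ suc) ⊕ g (suc i)    ≡⟨ ⊕-assoc _ _ _ ⟩
    f zero ⊕ (sumV F (f ∘ suc) ⊕ g (suc i))  ≡⟨ cong₂ _⊕_ (f≗g zero λ ()) tail-exchange ⟩
    g zero ⊕ (sumV F (g ∘ suc) ⊕ f (suc i))  ≡⟨ ⊕-assoc _ _ _ ⟨
    g zero ⊕ sumV F (g ∘ suc) ⊕ f (suc i)    ∎
    where
    tail-exchange : sumV F (f ∘ suc) ⊕ g (suc i) ≡ sumV F (g ∘ suc) ⊕ f (suc i)
    tail-exchange = sumV-exchange (f ∘ suc) (g ∘ suc) i λ k k≢i → f≗g (suc k) (k≢i ∘ Finₚ.suc-injective)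

  module ReplaceSummand {r h} {A B : FinSubset F r} (c : LinComb F h A) (i : Fin h) (t : Carrier) (e : V F r)
                 (t≢0 : t ≢ 0#) (e∈B : e ∈ elems B) (fresh : ∀ k → k ≢ i → vec c k ≢ e)
                 (others∈B : ∀ k → k ≢ i → vec c k ∈ elems B) where

    comb : LinComb F h B
    comb = record
      { vec = vec c [ i ]≔ e
      ; vec-inj = []≔-injective (vec-inj c) fresh
      ; vec-mem = []≔-preserves (_∈ elems B) e∈B others∈B
      ; coeff = coeff c [ i ]≔ t
      ; coeff-nz = []≔-preserves (_≢ 0#) t≢0 (λ k _ → coeff-nz c k)
      }

    vec-replaced : vec comb i ≡ e
    vec-replaced = []≔-updates (vec c) i e

    coeff-replaced : coeff comb i ≡ t
    coeff-replaced = []≔-updates (coeff c) i t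

    vec-kept : ∀ {k} → k ≢ i → vec comb k ≡ vec c k
    vec-kept = []≔-minimal (vec c) i e

    coeff-kept : ∀ {k} → k ≢ i → coeff comb k ≡ coeff c k
    coeff-kept = []≔-minimal (coeff c) i t

    value-comb : value F comb ⊕ coeff c i · vec c i ≡ value F c ⊕ t · e
    value-comb = begin
      value F comb ⊕ coeff c i · vec c i   ≡⟨ sumV-exchange _ _ i unchanged ⟩
      value F c ⊕ coeff comb i · vec comb i  ≡⟨ cong₂ (λ s v → value F c ⊕ s · v) coeff-replaced vec-replaced ⟩
      value F c ⊕ t · e                    ∎
      where
      unchanged : ∀ k → k ≢ i → coeff comb k · vec comb k ≡ coeff c k · vec c k
      unchanged k k≢i = cong₂ _·_ (coeff-kept k≢i) (vec-kept k≢i)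

    value-comb-𝟎 : vec c i ≡ 𝟎 F → value F comb ≡ value F c ⊕ t · e
    value-comb-𝟎 cᵢ≡𝟎 = begin
      value F comb                       ≡⟨ ⊕-identityʳ _ ⟨
      value F comb ⊕ 𝟎 F                 ≡⟨ cong (value F comb ⊕_) (trans (cong (coeff c i ·_) cᵢ≡𝟎) (·-𝟎 _)) ⟨
      value F comb ⊕ coeff c i · vec c i  ≡⟨ value-comb ⟩
      value F c ⊕ t · e                  ∎

    value-comb-shift : vec c i ≡ e → (s : Carrier) → t ≡ coeff c i + s → value F comb ≡ value F c ⊕ s · e
    value-comb-shift cᵢ≡e s t≡μ+s = ⊕-cancelʳ (μ · e) _ _ (begin
      value F comb ⊕ μ · e        ≡⟨ cong (λ v → value F comb ⊕ μ · v) cᵢ≡e ⟨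
      value F comb ⊕ μ · vec c i  ≡⟨ value-comb ⟩
      value F c ⊕ t · e           ≡⟨ cong (λ a → value F c ⊕ a · e) t≡μ+s ⟩
      value F c ⊕ (μ + s) · e     ≡⟨ cong (value F c ⊕_) (trans (·-distribʳ μ s e) (⊕-comm _ _)) ⟩
      value F c ⊕ (s · e ⊕ μ · e)  ≡⟨ ⊕-assoc _ _ _ ⟨
      value F c ⊕ s · e ⊕ μ · e   ∎)
      where
      μ : Carrier
      μ = coeff c i

  SameComb-matches : ∀ {r h} {A : FinSubset F r} (c d : LinComb F h A) (same : SameComb F c d) {i j : Fin h} →
                     vec c i ≡ vec d j → proj₁ same ⟨$⟩ʳ i ≡ j
  SameComb-matches c d (σ , agree) {i} cᵢ≡dⱼ = vec-inj d (trans (proj₁ (agree i)) cᵢ≡dⱼ)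

  ∃-unused-vector : ∀ {r h} {A : FinSubset F r} (B : FinSubset F r) → h ℕ.+ h < card F B →
                    (c d : LinComb F h A) → ∃ λ e → e ∈ elems B × (∀ k → vec c k ≢ e) × (∀ k → vec d k ≢ e)
  ∃-unused-vector {r} {h} B 2h<|B| c d
    with length<⇒∃∈∉ _≟ᵥ_ (unique B) (subst (_< card F B) (sym |used|≡h+h) 2h<|B|)
    where
    used : List (V F r)
    used = tabulate (vec c) ++ tabulate (vec d)

    |used|≡h+h : length used ≡ h ℕ.+ h
    |used|≡h+h = trans (length-++ (tabulate (vec c)))
                       (cong₂ ℕ._+_ (length-tabulate (vec c)) (length-tabulate (vec d)))
  ... | e , e∈B , e∉used =
    e , e∈B , (λ k cₖ≡e → e∉used (subst (_∈ _) cₖ≡e (∈-++⁺ˡ (∈-tabulate⁺ k))))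
            , (λ k dₖ≡e → e∉used (subst (_∈ _) dₖ≡e (∈-++⁺ʳ _ (∈-tabulate⁺ k))))

  Uses𝟎 : ∀ {r h} {A : FinSubset F r} → LinComb F h A → Set
  Uses𝟎 {h = h} c = ∃ λ (i : Fin h) → vec c i ≡ 𝟎 F

  uses𝟎? : ∀ {r h} {A : FinSubset F r} (c : LinComb F h A) → Dec (Uses𝟎 c)
  uses𝟎? c = Finₚ.any? (λ i → vec c i ≟ᵥ 𝟎 F)

  module Insert𝟎 {r h} (M : FinSubset F r) (M-linear : IsSₕLinear F h M) (𝟎∉M : 𝟎 F ∉ elems M) where

    M∪𝟎 : FinSubset F r
    M∪𝟎 = finSubset (𝟎 F ∷ elems M) (¬Any⇒All¬ (elems M) 𝟎∉M ∷ unique M)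

    ∈M∪𝟎∧≢𝟎⇒∈M : ∀ {v} → v ∈ elems M∪𝟎 → v ≢ 𝟎 F → v ∈ elems M
    ∈M∪𝟎∧≢𝟎⇒∈M (here v≡𝟎) v≢𝟎 = contradiction v≡𝟎 v≢𝟎
    ∈M∪𝟎∧≢𝟎⇒∈M (there v∈M) _ = v∈M

    others∈M : (c : LinComb F h M∪𝟎) {i : Fin h} → vec c i ≡ 𝟎 F → ∀ k → k ≢ i → vec c k ∈ elems M
    others∈M c cᵢ≡𝟎 k k≢i = ∈M∪𝟎∧≢𝟎⇒∈M (vec-mem c k) (λ cₖ≡𝟎 → k≢i (vec-inj c (trans cₖ≡𝟎 (sym cᵢ≡𝟎))))

    restrict : (c : LinComb F h M∪𝟎) → ¬ Uses𝟎 c → LinComb F h M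
    restrict c ¬c₀ = record
      { vec = vec c ; vec-inj = vec-inj c ; vec-mem = λ k → ∈M∪𝟎∧≢𝟎⇒∈M (vec-mem c k) (¬c₀ ∘ (k ,_))
      ; coeff = coeff c ; coeff-nz = coeff-nz c }

    both-use-𝟎 : h ℕ.+ h < card F M → (c d : LinComb F h M∪𝟎) →
                 Uses𝟎 c → Uses𝟎 d → value F c ≡ value F d → SameComb F c d
    both-use-𝟎 2h<|M| c d (i , cᵢ≡𝟎) (j , dⱼ≡𝟎) c≡d with ∃-unused-vector M 2h<|M| c d
    ... | e , e∈M , c∌e , d∌e = σ , agree
      where
      1≢0 : 1# ≢ 0#
      1≢0 = 0≢1 ∘ sym

      module C′ = ReplaceSummand c i 1# e 1≢0 e∈M (λ k _ → c∌e k) (others∈M c cᵢ≡𝟎)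
      module D′ = ReplaceSummand d j 1# e 1≢0 e∈M (λ k _ → d∌e k) (others∈M d dⱼ≡𝟎)

      c′≡d′ : value F C′.comb ≡ value F D′.comb
      c′≡d′ = trans (C′.value-comb-𝟎 cᵢ≡𝟎) (trans (cong (_⊕ 1# · e) c≡d) (sym (D′.value-comb-𝟎 dⱼ≡𝟎)))

      same : SameComb F C′.comb D′.comb
      same = M-linear C′.comb D′.comb c′≡d′

      σ : Permutation′ h
      σ = proj₁ same

      σi≡j : σ ⟨$⟩ʳ i ≡ j
      σi≡j = SameComb-matches C′.comb D′.comb same (trans C′.vec-replaced (sym D′.vec-replaced))

      σk≢j : ∀ {k} → k ≢ i → σ ⟨$⟩ʳ k ≢ j
      σk≢j k≢i σk≡j = k≢i (Injection.injective (↔⇒↣ σ) (trans σk≡j (sym σi≡j)))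

      agree : ∀ k → (vec d (σ ⟨$⟩ʳ k) ≡ vec c k) × (vec c k ≢ 𝟎 F → coeff d (σ ⟨$⟩ʳ k) ≡ coeff c k)
      agree k with k Finₚ.≟ i
      ... | yes refl =
        trans (cong (vec d) σi≡j) (trans dⱼ≡𝟎 (sym cᵢ≡𝟎)) , λ cᵢ≢𝟎 → contradiction cᵢ≡𝟎 cᵢ≢𝟎
      ... | no k≢i =
        trans (sym (D′.vec-kept (σk≢j k≢i))) (trans (proj₁ (proj₂ same k)) (C′.vec-kept k≢i)) ,
        λ cₖ≢𝟎 → trans (sym (D′.coeff-kept (σk≢j k≢i)))
                   (trans (proj₂ (proj₂ same k) (cₖ≢𝟎 ∘ trans (sym (C′.vec-kept k≢i)))) (C′.coeff-kept k≢i))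

    only-one-uses-𝟎 : 2 < order → (c d : LinComb F h M∪𝟎) →
                      Uses𝟎 c → ¬ Uses𝟎 d → value F c ≢ value F d
    only-one-uses-𝟎 2<q c d (i , cᵢ≡𝟎) ¬d₀ c≡d
      with ∃-outside-image _≟ᵥ_ (vec c) (vec d) (vec-inj d) i (λ j dⱼ≡cᵢ → ¬d₀ (j , trans dⱼ≡cᵢ cᵢ≡𝟎))
    ... | j , c∌dⱼ with ∃-shift-avoiding-0 2<q (coeff d j)
    ... | t , t≢0 , μ+t≢0 = coeff-nz d j μ≡0
      where
      μ : Carrier
      μ = coeff d j

      d≢𝟎 : ∀ k → vec d k ≢ 𝟎 F
      d≢𝟎 k = ¬d₀ ∘ (k ,_)

      module C′ = ReplaceSummand c i t (vec d j) t≢0 (∈M∪𝟎∧≢𝟎⇒∈M (vec-mem d j) (d≢𝟎 j))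
                                 (λ k _ → c∌dⱼ k) (others∈M c cᵢ≡𝟎)
      module D′ = ReplaceSummand d j (μ + t) (vec d j) μ+t≢0 (∈M∪𝟎∧≢𝟎⇒∈M (vec-mem d j) (d≢𝟎 j))
                                 (λ k k≢j → k≢j ∘ vec-inj d) (λ k _ → ∈M∪𝟎∧≢𝟎⇒∈M (vec-mem d k) (d≢𝟎 k))

      c′≡d′ : value F C′.comb ≡ value F D′.comb
      c′≡d′ = trans (C′.value-comb-𝟎 cᵢ≡𝟎)
                    (trans (cong (_⊕ t · vec d j) c≡d) (sym (D′.value-comb-shift refl t refl)))

      same : SameComb F C′.comb D′.comb
      same = M-linear C′.comb D′.comb c′≡d′

      σi≡j : proj₁ same ⟨$⟩ʳ i ≡ j
      σi≡j = SameComb-matches C′.comb D′.comb same (trans C′.vec-replaced (sym D′.vec-replaced))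

      μ+t≡t : μ + t ≡ t
      μ+t≡t = begin
        μ + t                               ≡⟨ D′.coeff-replaced ⟨
        coeff D′.comb j                     ≡⟨ cong (coeff D′.comb) σi≡j ⟨
        coeff D′.comb (proj₁ same ⟨$⟩ʳ i)    ≡⟨ proj₂ (proj₂ same i) (d≢𝟎 j ∘ trans (sym C′.vec-replaced)) ⟩
        coeff C′.comb i                     ≡⟨ C′.coeff-replaced ⟩
        t                                   ∎

      μ≡0 : μ ≡ 0#
      μ≡0 = +-cancelʳ t μ 0# (trans μ+t≡t (sym (+-identityˡ t)))

    M∪𝟎-linear : 2 < order → h ℕ.+ h < card F M → IsSₕLinear F h M∪𝟎
    M∪𝟎-linear 2<q 2h<|M| c d c≡d with uses𝟎? c | uses𝟎? d
    ... | yes c₀ | yes d₀ = both-use-𝟎 2h<|M| c d c₀ d₀ c≡d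
    ... | yes c₀ | no ¬d₀ = contradiction c≡d (only-one-uses-𝟎 2<q c d c₀ ¬d₀)
    ... | no ¬c₀ | yes d₀ = contradiction (sym c≡d) (only-one-uses-𝟎 2<q d c d₀ ¬c₀)
    ... | no ¬c₀ | no ¬d₀ = M-linear (restrict c ¬c₀) (restrict d ¬d₀) c≡d

  maximal⇒𝟎∈ : ∀ {r h} (M : FinSubset F r) → IsMaximalSₕLinear F h M → 2 < order →
               h ℕ.+ h < card F M → 𝟎 F ∈ elems M
  maximal⇒𝟎∈ M (M-linear , M-maximal) 2<q 2h<|M| with Any.any? (𝟎 F ≟ᵥ_) (elems M)
  ... | yes 𝟎∈M = 𝟎∈M
  ... | no 𝟎∉M = M-maximal M∪𝟎 (M∪𝟎-linear 2<q 2h<|M|) there (here refl)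
    where open Insert𝟎 M M-linear 𝟎∉M

corollary3p13 : (F : FiniteField) → FiniteField.order F ≢ 2 →
    (r h : ℕ) → 1 ≤ h → (M : FinSubset F r) →
    IsMaximalSₕLinear F h M → 2 * h < r → r ≤ card F M →
    𝟎 F ∈ elems M
corollary3p13 F order≢2 r h _ M M-maximal 2h<r r≤|M| =
  maximal⇒𝟎∈ F M M-maximal (order≢2⇒2<order F order≢2) (ℕₚ.<-≤-trans h+h<r r≤|M|)
  where
  h+h<r : h ℕ.+ h < r
  h+h<r = subst (_< r) (cong (h ℕ.+_) (ℕₚ.+-identityʳ h)) 2h<r
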